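{- Let $G=(V,E)$ be a connected graph with $n\ge 2$ vertices, $b$ an integer with $1\le b<n$, $\mathcal{D}$ a fixed rooted spanning tree of $G$, and $\phi$ a segment assignment. Let $\pi$ be a $b$-ordering consistent with $\phi$. For $0\le k\le n$ let $s_k$ be the state candidate whose domain is the set of vertices $v$ such that $\pi(v)$ is among the first $k$ positions in the color order, and which assigns to each such $v$ the base segment containing $\pi(v)$. Then every $s_k$ is a state, and for every $0\le k<n$ the state $s_{k+1}$ is an extension of $s_k$.
   Context: A $b$-ordering is a bijection $\pi:V\to\{1,\dots,n\}$ with $|\pi(u)-\pi(v)|\le b$ for every $uv\in E$. For integers $i<j$, the segment $\Theta_{(i,j)}$ is $\{i(b+1)+1,\dots,j(b+1)\}\cap\{1,\dots,n\}$, considered only when nonempty; $\Theta_i:=\Theta_{(i,i+1)}$ are base segments. For a position $p$, $\mathtt{segment}(p)=\lceil p/(b+1)\rceil$, $\mathtt{color}(p)=((p-1)\bmod(b+1))+1$; the color order sorts positions $1,\dots,n$ lexicographically by $(\mathtt{color}(p),\mathtt{segment}(p))$. In $\mathcal{D}$, a leaf is a non-root vertex with no children; other vertices (including the root) are inner. A segment assignment is a function $\phi$ assigning a segment to every vertex such that: (1) every leaf gets a segment $\Theta_{(i,i+4)}$; (2) every inner vertex gets a segment $\Theta_{(i,i+2)}$; (3) if $u$ is the parent of an inner vertex $v$ in $\mathcal{D}$, $\phi(u)=\Theta_{(i,i+2)}$, $\phi(v)=\Theta_{(j,j+2)}$, then $|i-j|=1$; (4) if $v$ is a leaf with parent $u$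 and $\phi(u)=\Theta_{(i,i+2)}$, then $\phi(v)=\Theta_{(i-1,i+3)}$. $\phi$ is consistent with $\pi$ if $\pi(v)\in\phi(v)$ for all $v$. A state candidate is a partial function $s$ from $V$ to $\{\Theta_i: 0\le i<\lceil n/(b+1)\rceil\}$ such that $s(v)\subseteq\phi(v)$ whenever $s(v)$ is defined; $\mathrm{dom}(s)$ is its domain. A state is a state candidate $s$ such that: (1) the vertices of $\mathrm{dom}(s)$ can be bijectively assigned to the first $|\mathrm{dom}(s)|$ positions in the color order so that each $v$ gets a position in $s(v)$; (2) for every edge $uv\in E$: either both $s(u),s(v)$ are undefined; or exactly one is defined, say $s(v)=\Theta_i$ and $s(u)$ undefined, and then, writing $\phi(u)=\Theta_{(k,l)}$, we have $k\le i$; or both are defined, $s(v)=\Theta_i$, $s(u)=\Theta_k$, and $|i-k|\le1$. A state $s'$ is an extension of a state $s$ if there is a vertex $v$ with: $s(v)$ undefined and $s'(v)$ defined; $\mathrm{dom}(s')=\mathrm{dom}(s)\cup\{v\}$ and $s'$ restricted to $\mathrm{dom}(s)$ equals $s$; and for every edge $uv\in E$ with $s'(u)=\Theta_k$ and $s'(v)=\Theta_i$, we have $k-1\le i\le k$. -}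

module Defs where

open import Data.Bool using (Bool; true; false; _∧_; _∨_; if_then_else_)
open import Data.Nat as ℕ using (ℕ; zero; suc; _+_; _*_; _∸_; _≤_; _<_; _<ᵇ_; _≡ᵇ_; ∣_-_∣)
open import Data.Nat.DivMod using (_/_; _%_)
open import Data.Integer as ℤ using (ℤ; +_)
open import Data.Fin using (Fin; toℕ)
open import Data.Fin.Permutation using (Permutation′; _⟨$⟩ʳ_)
open import Data.Maybe using (Maybe; just; nothing; is-just)
open import Data.Product using (Σ; ∃; ∃-syntax; _×_; _,_; proj₁; proj₂)
open import Data.Unit using (⊤)
open import Data.List using (List; length; filterᵇ; map; upTo; allFin)
open import Relation.Nullary using (¬_)
open import Relation.Binary.PropositionalEquality using (_≡_; _≢_)
open import Relation.Binary.Construct.Closure.ReflexiveTransitive using (Star)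

record SimpleGraph (n : ℕ) : Set₁ where
  field
    Adj    : Fin n → Fin n → Set
    sym    : ∀ {u v} → Adj u v → Adj v u
    irrefl : ∀ {v} → ¬ Adj v v
open SimpleGraph public

Connected : ∀ {n} → SimpleGraph n → Set
Connected G = ∀ u v → Star (Adj G) u v

iter : ∀ {A : Set} → (A → A) → ℕ → A → A
iter f zero    x = x
iter f (suc m) x = iter f m (f x)

-- The value  parent root  is irrelevant.
record RootedSpanningTree {n : ℕ} (G : SimpleGraph n) : Set where
  field
    root         : Fin n
    parent       : Fin n → Fin n
    parent-adj   : ∀ v → v ≢ root → Adj G v (parent v)
    reaches-root : ∀ v → ∃[ m ] iter parent m v ≡ root
open RootedSpanningTree public

IsChild : ∀ {n} {G : SimpleGraph n} → RootedSpanningTree G → Fin n → Fin n → Set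
IsChild D v u = (v ≢ root D) × (parent D v ≡ u)

IsLeaf : ∀ {n} {G : SimpleGraph n} → RootedSpanningTree G → Fin n → Set
IsLeaf D v = (v ≢ root D) × (∀ w → ¬ IsChild D w v)

IsInner : ∀ {n} {G : SimpleGraph n} → RootedSpanningTree G → Fin n → Set
IsInner D v = ¬ IsLeaf D v

InSeg : (n b : ℕ) → ℤ → ℤ → ℕ → Set
InSeg n b i j p =
  (1 ≤ p) × (p ≤ n) ×
  (i ℤ.* + suc b ℤ.+ ℤ.1ℤ ℤ.≤ + p) × (+ p ℤ.≤ j ℤ.* + suc b)

NonEmptySeg : (n b : ℕ) → ℤ → ℤ → Set
NonEmptySeg n b i j = ∃[ p ] InSeg n b i j p

InBase : (n b : ℕ) → ℕ → ℕ → Set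
InBase n b i p = InSeg n b (+ i) (+ suc i) p

-- number of base segments ⌈n/(b+1)⌉
numBase : (n b : ℕ) → ℕ
numBase n b = (n + b) / suc b

-- segment(p) = ⌈p/(b+1)⌉,  color(p) = ((p-1) mod (b+1)) + 1
segment : (b p : ℕ) → ℕ
segment b p = (p + b) / suc b

color : (b p : ℕ) → ℕ
color b p = suc ((p ∸ 1) % suc b)

colorLtᵇ : (b q p : ℕ) → Bool
colorLtᵇ b q p =
  (color b q <ᵇ color b p) ∨ ((color b q ≡ᵇ color b p) ∧ (segment b q <ᵇ segment b p))

positions : ℕ → List ℕ
positions n = map suc (upTo n)

-- index (0-based) of position p in the color order of positions 1..n
rank : (n b p : ℕ) → ℕ
rank n b p = length (filterᵇ (λ q → colorLtᵇ b q p) (positions n))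

InFirst : (n b k p : ℕ) → Set
InFirst n b k p = (1 ≤ p) × (p ≤ n) × (rank n b p < k)

pos : ∀ {n} → Permutation′ n → Fin n → ℕ
pos π v = suc (toℕ (π ⟨$⟩ʳ v))

IsBOrdering : ∀ {n} → ℕ → SimpleGraph n → Permutation′ n → Set
IsBOrdering b G π = ∀ u v → Adj G u v → ∣ pos π u - pos π v ∣ ≤ b

-- Segment assignments: φ v = (i , j) stands for the segment Θ_(i,j)

lo hi : ∀ {n} → (Fin n → ℤ × ℤ) → Fin n → ℤ
lo φ v = proj₁ (φ v)
hi φ v = proj₂ (φ v)

record IsSegmentAssignment (n b : ℕ) {G : SimpleGraph n}
         (D : RootedSpanningTree G) (φ : Fin n → ℤ × ℤ) : Set where
  field
    nonempty  : ∀ v → NonEmptySeg n b (lo φ v) (hi φ v)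
    leaf-len  : ∀ v → IsLeaf D v → hi φ v ≡ lo φ v ℤ.+ + 4
    inner-len : ∀ v → IsInner D v → hi φ v ≡ lo φ v ℤ.+ + 2
    inner-par : ∀ u v → IsChild D v u → IsInner D v →
                ℤ.∣ lo φ u ℤ.- lo φ v ∣ ≡ 1
    leaf-par  : ∀ u v → IsChild D v u → IsLeaf D v →
                (lo φ v ≡ lo φ u ℤ.- ℤ.1ℤ) × (hi φ v ≡ lo φ u ℤ.+ + 3)

ConsistentWith : ∀ {n} → (b : ℕ) → Permutation′ n → (Fin n → ℤ × ℤ) → Set
ConsistentWith {n} b π φ = ∀ v → InSeg n b (lo φ v) (hi φ v) (pos π v)

-- State candidates and states: s v = just i means s(v) = Θ_i

IsStateCandidate : (n b : ℕ) → (Fin n → ℤ × ℤ) → (Fin n → Maybe ℕ) → Set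
IsStateCandidate n b φ s =
  ∀ v i → s v ≡ just i →
    (i < numBase n b) × (∀ p → InBase n b i p → InSeg n b (lo φ v) (hi φ v) p)

domSize : ∀ {n} → (Fin n → Maybe ℕ) → ℕ
domSize {n} s = length (filterᵇ (λ v → is-just (s v)) (allFin n))

StateCond1 : (n b : ℕ) → (Fin n → Maybe ℕ) → Set
StateCond1 n b s =
  Σ (Fin n → ℕ) λ f → ((∀ v i → s v ≡ just i → InFirst n b (domSize s) (f v) × InBase n b i (f v))
        × (∀ u v i j → s u ≡ just i → s v ≡ just j → f u ≡ f v → u ≡ v)
        × (∀ p → InFirst n b (domSize s) p → ∃[ v ] ∃[ i ] (s v ≡ just i) × (f v ≡ p)))

-- (2): the edge condition, for the ordered pair (u,v) (E is symmetric)
EdgeOK : Maybe ℕ → Maybe ℕ → ℤ → ℤ → Set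
EdgeOK nothing  nothing  ku kv = ⊤
EdgeOK nothing  (just i) ku kv = ku ℤ.≤ + i
EdgeOK (just i) nothing  ku kv = kv ℤ.≤ + i
EdgeOK (just k) (just i) ku kv = ℤ.∣ + i ℤ.- + k ∣ ≤ 1

IsState : (n b : ℕ) → SimpleGraph n → (Fin n → ℤ × ℤ) → (Fin n → Maybe ℕ) → Set
IsState n b G φ s =
  IsStateCandidate n b φ s × StateCond1 n b s ×
  (∀ u v → Adj G u v → EdgeOK (s u) (s v) (lo φ u) (lo φ v))

IsExtension : ∀ {n} → SimpleGraph n → (s s' : Fin n → Maybe ℕ) → Set
IsExtension {n} G s s' =
  ∃[ v ] ((s v ≡ nothing) × (∃[ i ] s' v ≡ just i)
        × (∀ w → w ≢ v → s' w ≡ s w)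
        × (∀ u k i → Adj G u v → s' u ≡ just k → s' v ≡ just i →
             (+ k ℤ.- ℤ.1ℤ ℤ.≤ + i) × (i ≤ k)))

-- s_k: vertices at the first k positions of the color order, each mapped
-- to the base segment containing π(v), i.e. Θ_{segment(π(v)) - 1}

sₖ : (n b : ℕ) → Permutation′ n → ℕ → Fin n → Maybe ℕ
sₖ n b π k v =
  if rank n b (pos π v) <ᵇ k then just (segment b (pos π v) ∸ 1) else nothing

-- Let r(v) be the rank of π(v) in the color order.  The color order is a
-- strict total order on the positions 1..n, so r is a bijection onto
-- {0,…,n-1}: s_k holds exactly the k vertices of rank < k, and s_{k+1} adds
-- the vertex of rank k; placing each vertex at π(v) witnesses condition (1).  Neighbours are at most b
-- apart, so their base segments are adjacent.  If u precedes its neighbour v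
-- in the color order, v's segment is not after u's: a later segment with a
-- color at least as large would put π(v) at least b+1 after π(u).  Finally
-- π(v) ∈ φ(v) bounds the lower end of φ(v) by the base segment of π(v).
module Submission where

open import Defs hiding (sym)
open import Data.Bool using (Bool; true; false; T)
open import Data.Empty using (⊥-elim)
open import Data.Fin as Fin using (Fin; toℕ; fromℕ<; punchOut)
open import Data.Fin.Permutation using (Permutation′; _⟨$⟩ʳ_; _⟨$⟩ˡ_; inverseʳ)
open import Data.Fin.Properties using (toℕ<n; toℕ-injective; toℕ-fromℕ<; punchOut-injective; injective⇒≤; any?)
open import Data.Integer as ℤ using (ℤ; +_; -[1+_]; +≤+; -≤+)
import Data.Integer.Properties as ℤ
open import Data.List using ([]; _∷_; length; filterᵇ; upTo; allFin)
open import Data.List.Membership.Propositional using (_∈_)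
open import Data.List.Membership.Propositional.Properties using (∈-map⁺; ∈-upTo⁺; ∈-allFin)
open import Data.List.Properties using (length-map; length-upTo; length-filter; length-tabulate; filter-notAll)
open import Data.List.Relation.Unary.Any as Any using (here; there)
open import Data.Maybe using (just; nothing; is-just)
open import Data.Maybe.Properties using (just-injective)
open import Data.Nat
open import Data.Nat.DivMod
open import Data.Nat.Properties
open import Data.Product using (∃-syntax; _×_; _,_; proj₁; proj₂)
open import Data.Product.Relation.Binary.Lex.Strict using (×-strictTotalOrder)
open import Data.Sum using (inj₁; inj₂)
open import Data.Unit using (tt)
open import Function using (_∘_; id)
open import Function.Definitions using (Injective)
open import Function.Bundles using (Injection)
open import Function.Properties.Inverse using (↔⇒↣)
open import Relation.Binary using (StrictTotalOrder; Tri; tri<; tri≈; tri>)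
open import Relation.Binary.PropositionalEquality
open import Relation.Nullary using (¬_; yes; no; contradiction)
open import Relation.Nullary.Decidable using (T?)
open import Relation.Nullary.Reflects using (Reflects; ofʸ; ofⁿ; fromEquivalence; _⊎-reflects_; _×-reflects_)

module _ {A : Set} {p q : A → Bool} (p⇒q : ∀ x → T (p x) → T (q x)) where

  length-filterᵇ-mono : ∀ xs → length (filterᵇ p xs) ≤ length (filterᵇ q xs)
  length-filterᵇ-mono []       = z≤n
  length-filterᵇ-mono (x ∷ xs) with p x | q x | p⇒q x
  ... | true  | true  | _      = s≤s (length-filterᵇ-mono xs)
  ... | true  | false | px⇒qx = ⊥-elim (px⇒qx _)
  ... | false | true  | _      = m≤n⇒m≤1+n (length-filterᵇ-mono xs)
  ... | false | false | _      = length-filterᵇ-mono xs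

  length-filterᵇ-mono-< : ∀ {y xs} → y ∈ xs → ¬ T (p y) → T (q y) →
                          length (filterᵇ p xs) < length (filterᵇ q xs)
  length-filterᵇ-mono-< {xs = x ∷ xs} (here refl) ¬py qy with p x | q x
  ... | true  | _     = ⊥-elim (¬py _)
  ... | false | true  = s≤s (length-filterᵇ-mono xs)
  ... | false | false = ⊥-elim qy
  length-filterᵇ-mono-< {xs = x ∷ xs} (there y∈xs) ¬py qy with p x | q x | p⇒q x
  ... | true  | true  | _      = s≤s (length-filterᵇ-mono-< y∈xs ¬py qy)
  ... | true  | false | px⇒qx = ⊥-elim (px⇒qx _)
  ... | false | true  | _      = m≤n⇒m≤1+n (length-filterᵇ-mono-< y∈xs ¬py qy)
  ... | false | false | _      = length-filterᵇ-mono-< y∈xs ¬py qy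

module _ {n : ℕ} (c : ℕ → ℕ) (c-< : ∀ {k} → k < n → c k < c (suc k)) where

  increasing⇒≤ : ∀ {k} → k ≤ n → k ≤ c k
  increasing⇒≤ {zero}  _   = z≤n
  increasing⇒≤ {suc k} k<n = ≤-<-trans (increasing⇒≤ (<⇒≤ k<n)) (c-< k<n)

  increasing-bounded⇒≤ : c n ≤ n → ∀ d {k} → k + d ≡ n → c k ≤ k
  increasing-bounded⇒≤ cn≤n zero {k} k+0≡n =
    subst (λ m → c m ≤ m) (trans (sym k+0≡n) (+-identityʳ k)) cn≤n
  increasing-bounded⇒≤ cn≤n (suc d) {k} k+1+d≡n =
    s≤s⁻¹ (<-≤-trans (c-< k<n) (increasing-bounded⇒≤ cn≤n d (trans (sym (+-suc k d)) k+1+d≡n)))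
    where
    k<n : k < n
    k<n = subst (k <_) k+1+d≡n (m<m+n k z<s)

  increasing-bounded⇒identity : c n ≤ n → ∀ {k} → k ≤ n → c k ≡ k
  increasing-bounded⇒identity cn≤n k≤n =
    ≤-antisym (increasing-bounded⇒≤ cn≤n _ (m+[n∸m]≡n k≤n)) (increasing⇒≤ k≤n)

injective⇒surjective : ∀ {n} (f : Fin n → Fin n) → Injective _≡_ _≡_ f → ∀ y → ∃[ x ] f x ≡ y
injective⇒surjective {suc n} f f-injective y with any? (λ x → f x Fin.≟ y)
... | yes fx≡y = fx≡y
... | no  ∄x   = contradiction (injective⇒≤ g-injective) 1+n≰n
  where
  y≢f : ∀ x → y ≢ f x
  y≢f x y≡fx = ∄x (x , sym y≡fx)

  g : Fin (suc n) → Fin n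
  g x = punchOut (y≢f x)

  g-injective : Injective _≡_ _≡_ g
  g-injective = f-injective ∘ punchOut-injective (y≢f _) (y≢f _)

[m+n]/n≡1+m/n : ∀ m n .{{_ : NonZero n}} → (m + n) / n ≡ suc (m / n)
[m+n]/n≡1+m/n m n = trans (m/n≡1+[m∸n]/n (m≤n+m n m)) (cong (λ x → suc (x / n)) (m+n∸n≡m m n))

m<[1+m/n]*n : ∀ m n .{{_ : NonZero n}} → m < suc (m / n) * n
m<[1+m/n]*n m n = begin-strict
  m                 ≡⟨ m≡m%n+[m/n]*n m n ⟩
  m % n + m / n * n <⟨ +-monoˡ-< (m / n * n) (m%n<n m n) ⟩
  n + m / n * n     ∎
  where open ≤-Reasoning

m≤n+o⇒m/o≤1+n/o : ∀ {m n o} .{{_ : NonZero o}} → m ≤ n + o → m / o ≤ suc (n / o)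
m≤n+o⇒m/o≤1+n/o {m} {n} {o} m≤n+o = begin
  m / o       ≤⟨ /-monoˡ-≤ o m≤n+o ⟩
  (n + o) / o ≡⟨ [m+n]/n≡1+m/n n o ⟩
  suc (n / o) ∎
  where open ≤-Reasoning

m%o≤n%o⇒m/o<n/o⇒m+o≤n : ∀ {m n o} .{{_ : NonZero o}} → m % o ≤ n % o → m / o < n / o → m + o ≤ n
m%o≤n%o⇒m/o<n/o⇒m+o≤n {m} {n} {o} m%o≤n%o m/o<n/o = begin
  m + o                   ≡⟨ cong (_+ o) (m≡m%n+[m/n]*n m o) ⟩
  m % o + m / o * o + o   ≡⟨ +-assoc (m % o) _ o ⟩
  m % o + (m / o * o + o) ≡⟨ cong (_+_ (m % o)) (+-comm _ o) ⟩
  m % o + suc (m / o) * o ≤⟨ +-mono-≤ m%o≤n%o (*-monoˡ-≤ o m/o<n/o) ⟩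
  n % o + n / o * o       ≡⟨ sym (m≡m%n+[m/n]*n n o) ⟩
  n                       ∎
  where open ≤-Reasoning

∣m-n∣≤o⇒m≤n+o : ∀ {m n o} → ∣ m - n ∣ ≤ o → m ≤ n + o
∣m-n∣≤o⇒m≤n+o {m} {n} ∣m-n∣≤o = ≤-trans (m≤n+∣m-n∣ m n) (+-monoʳ-≤ n ∣m-n∣≤o)

m≤1+n⇒m∸n≤1 : ∀ {m n} → m ≤ suc n → m ∸ n ≤ 1
m≤1+n⇒m∸n≤1 {m} {n} m≤1+n = ≤-trans (∸-monoˡ-≤ n m≤1+n) (≤-reflexive (m+n∸n≡m 1 n))

∣+m-+n∣≤1 : ∀ {m n} → m ≤ suc n → n ≤ suc m → ℤ.∣ + m ℤ.- + n ∣ ≤ 1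
∣+m-+n∣≤1 {m} {n} m≤1+n n≤1+m rewrite ℤ.m-n≡m⊖n m n with m ≤? n
... | yes m≤n = subst (_≤ 1) (sym (ℤ.∣⊖∣-≤ m≤n)) (m≤1+n⇒m∸n≤1 n≤1+m)
... | no  m≰n = subst (_≤ 1) (sym (trans (ℤ.∣m⊖n∣≡∣n⊖m∣ m n) (ℤ.∣⊖∣-≤ (≰⇒≥ m≰n))))
                      (m≤1+n⇒m∸n≤1 m≤1+n)

+m-1≤+n : ∀ {m n} → m ≤ suc n → + m ℤ.- ℤ.1ℤ ℤ.≤ + n
+m-1≤+n {zero}  _     = -≤+
+m-1≤+n {suc m} m≤1+n = +≤+ (s≤s⁻¹ m≤1+n)

lo*d+1≤1+m⇒lo≤m/d : ∀ {lo m d} .{{_ : NonZero d}} → lo ℤ.* + d ℤ.+ ℤ.1ℤ ℤ.≤ + suc m → lo ℤ.≤ + (m / d)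
lo*d+1≤1+m⇒lo≤m/d { -[1+ _ ]} _ = -≤+
lo*d+1≤1+m⇒lo≤m/d {+ l} {m} {d} l*d+1≤1+m = +≤+ (subst (_≤ m / d) (m*n/n≡m l d) (/-monoˡ-≤ d l*d≤m))
  where
  l*d≤m : l * d ≤ m
  l*d≤m = s≤s⁻¹ (subst (_≤ suc m) (+-comm (l * d) 1)
            (ℤ.drop‿+≤+ (subst (λ z → z ℤ.+ ℤ.1ℤ ℤ.≤ + suc m) (sym (ℤ.pos-* l d)) l*d+1≤1+m)))

1+m≤hi*d⇒1+m/d≤hi : ∀ {hi m d} .{{_ : NonZero d}} → + suc m ℤ.≤ hi ℤ.* + d → + suc (m / d) ℤ.≤ hi
1+m≤hi*d⇒1+m/d≤hi {+ h} {m} {d} 1+m≤h*d =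
  +≤+ (m<n*o⇒m/o<n (ℤ.drop‿+≤+ (subst (+ suc m ℤ.≤_) (sym (ℤ.pos-* h d)) 1+m≤h*d)))
1+m≤hi*d⇒1+m/d≤hi { -[1+ _ ]} {d = suc _} ()

segment-suc : ∀ b m → segment b (suc m) ≡ suc (m / suc b)
segment-suc b m = trans (cong (_/ suc b) (sym (+-suc m b))) ([m+n]/n≡1+m/n m (suc b))

module _ {n b : ℕ} where

  InBase-/ : ∀ {m} → m < n → InBase n b (m / suc b) (suc m)
  InBase-/ {m} m<n =
    s≤s z≤n , m<n ,
    subst (λ z → z ℤ.+ ℤ.1ℤ ℤ.≤ + suc m) (ℤ.pos-* (m / suc b) (suc b))
      (+≤+ (subst (m / suc b * suc b + 1 ≤_) (+-comm m 1) (+-monoˡ-≤ 1 (m/n*n≤m m (suc b))))) ,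
    subst (+ suc m ℤ.≤_) (ℤ.pos-* (suc (m / suc b)) (suc b)) (+≤+ (m<[1+m/n]*n m (suc b)))

  InBase⊆InSeg : ∀ {lo hi m} → InSeg n b lo hi (suc m) → ∀ p → InBase n b (m / suc b) p → InSeg n b lo hi p
  InBase⊆InSeg {lo} {hi} (_ , _ , lo<1+m , 1+m≤hi) _ (1≤p , p≤n , base<p , p≤base) =
    1≤p , p≤n ,
    ℤ.≤-trans (ℤ.+-monoˡ-≤ ℤ.1ℤ (ℤ.*-monoʳ-≤-nonNeg (+ suc b) (lo*d+1≤1+m⇒lo≤m/d {lo} lo<1+m)))
              base<p ,
    ℤ.≤-trans p≤base (ℤ.*-monoʳ-≤-nonNeg (+ suc b) (1+m≤hi*d⇒1+m/d≤hi {hi} 1+m≤hi))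

  /<numBase : ∀ {m} → m < n → m / suc b < numBase n b
  /<numBase {m} m<n = begin-strict
    m / suc b           <⟨ n<1+n _ ⟩
    suc (m / suc b)     ≡⟨ [m+n]/n≡1+m/n m (suc b) ⟨
    (m + suc b) / suc b ≤⟨ /-monoˡ-≤ (suc b) (subst (_≤ n + b) (sym (+-suc m b)) (+-monoˡ-≤ b m<n)) ⟩
    (n + b) / suc b     ∎
    where open ≤-Reasoning

module ColorOrder (b : ℕ) where

  colorKey : ℕ → ℕ × ℕ
  colorKey p = color b p , segment b p

  private
    module Lex = StrictTotalOrder (×-strictTotalOrder <-strictTotalOrder <-strictTotalOrder)

  -- Opaque so that p ≺ q stays rigid and its implicit arguments can be inferred.
  opaque
    _≺_ : ℕ → ℕ → Set
    p ≺ q = Lex._<_ (colorKey p) (colorKey q)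

  colorKey-injective : ∀ {x y} → colorKey (suc x) ≡ colorKey (suc y) → x ≡ y
  colorKey-injective {x} {y} keys≡ = begin
    x                         ≡⟨ m≡m%n+[m/n]*n x (suc b) ⟩
    x % suc b + x / suc b * suc b
      ≡⟨ cong₂ (λ r q → r + q * suc b) (suc-injective (cong proj₁ keys≡)) (suc-injective segments≡) ⟩
    y % suc b + y / suc b * suc b ≡⟨ m≡m%n+[m/n]*n y (suc b) ⟨
    y                         ∎
    where
    open ≡-Reasoning
    segments≡ : suc (x / suc b) ≡ suc (y / suc b)
    segments≡ = trans (sym (segment-suc b x)) (trans (cong proj₂ keys≡) (segment-suc b y))

  opaque
    unfolding _≺_

    colorLtᵇ-reflects : ∀ p q → Reflects (p ≺ q) (colorLtᵇ b p q)
    colorLtᵇ-reflects p q =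
      <ᵇ-reflects-< _ _ ⊎-reflects fromEquivalence (≡ᵇ⇒≡ _ _) (≡⇒≡ᵇ _ _) ×-reflects <ᵇ-reflects-< _ _

    ≺-irrefl : ∀ {p} → ¬ p ≺ p
    ≺-irrefl = Lex.irrefl (refl , refl)

    ≺-trans : ∀ {p q r} → p ≺ q → q ≺ r → p ≺ r
    ≺-trans = Lex.trans

    ≺-compare : ∀ x y → Tri (suc x ≺ suc y) (x ≡ y) (suc y ≺ suc x)
    ≺-compare x y with Lex.compare (colorKey (suc x)) (colorKey (suc y))
    ... | tri< x≺y x≢y y⊀x = tri< x≺y (λ { refl → x≢y (refl , refl) }) y⊀x
    ... | tri≈ x⊀y (c≡ , s≡) y⊀x = tri≈ x⊀y (colorKey-injective (cong₂ _,_ c≡ s≡)) y⊀x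
    ... | tri> x⊀y x≢y y≺x = tri> x⊀y (λ { refl → x≢y (refl , refl) }) y≺x

    ≺⇒%≤ : ∀ {x y} → suc x ≺ suc y → x % suc b ≤ y % suc b
    ≺⇒%≤ (inj₁ color<)       = <⇒≤ (s≤s⁻¹ color<)
    ≺⇒%≤ (inj₂ (color≡ , _)) = ≤-reflexive (suc-injective color≡)

  colorLtᵇ⇒≺ : ∀ {p q} → T (colorLtᵇ b p q) → p ≺ q
  colorLtᵇ⇒≺ {p} {q} with colorLtᵇ b p q | colorLtᵇ-reflects p q
  ... | true | ofʸ p≺q = λ _ → p≺q

  ≺⇒colorLtᵇ : ∀ {p q} → p ≺ q → T (colorLtᵇ b p q)
  ≺⇒colorLtᵇ {p} {q} p≺q with colorLtᵇ b p q | colorLtᵇ-reflects p q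
  ... | true  | _       = tt
  ... | false | ofⁿ p⊀q = p⊀q p≺q

  segment-≺-nearby : ∀ {x y} → suc x ≺ suc y → y ≤ x + b → y / suc b ≤ x / suc b
  segment-≺-nearby {x} {y} x≺y y≤x+b with y / suc b ≤? x / suc b
  ... | yes y/≤x/ = y/≤x/
  ... | no  y/≰x/ = contradiction (+-cancelˡ-≤ x _ _ x+1+b≤x+b) 1+n≰n
    where
    x+1+b≤x+b : x + suc b ≤ x + b
    x+1+b≤x+b = ≤-trans (m%o≤n%o⇒m/o<n/o⇒m+o≤n (≺⇒%≤ x≺y) (≰⇒> y/≰x/)) y≤x+b

module Rank (n b : ℕ) where
  open ColorOrder b

  private
    length-positions : length (positions n) ≡ n
    length-positions = trans (length-map suc (upTo n)) (length-upTo n)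

    ∈-positions : ∀ {x} → x < n → suc x ∈ positions n
    ∈-positions x<n = ∈-map⁺ suc (∈-upTo⁺ x<n)

  rank<n : ∀ {x} → x < n → rank n b (suc x) < n
  rank<n {x} x<n = subst (rank n b (suc x) <_) length-positions
    (filter-notAll (λ q → T? (colorLtᵇ b q (suc x))) (positions n)
      (Any.map (λ { refl → ≺-irrefl ∘ colorLtᵇ⇒≺ {suc x} }) (∈-positions x<n)))

  rank-mono : ∀ {x y} → x < n → suc x ≺ suc y → rank n b (suc x) < rank n b (suc y)
  rank-mono {x} {y} x<n x≺y =
    length-filterᵇ-mono-< (λ z z≺x → ≺⇒colorLtᵇ (≺-trans (colorLtᵇ⇒≺ {z} z≺x) x≺y))
      (∈-positions x<n) (≺-irrefl ∘ colorLtᵇ⇒≺ {suc x}) (≺⇒colorLtᵇ x≺y)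

  rank-injective : ∀ {x y} → x < n → y < n → rank n b (suc x) ≡ rank n b (suc y) → x ≡ y
  rank-injective {x} {y} x<n y<n ranks≡ with ≺-compare x y
  ... | tri< x≺y _ _ = contradiction ranks≡ (<⇒≢ (rank-mono x<n x≺y))
  ... | tri≈ _ x≡y _ = x≡y
  ... | tri> _ _ y≺x = contradiction (sym ranks≡) (<⇒≢ (rank-mono y<n y≺x))

  rank-<⇒≺ : ∀ {x y} → y < n → rank n b (suc x) < rank n b (suc y) → suc x ≺ suc y
  rank-<⇒≺ {x} {y} y<n ranks< with ≺-compare x y
  ... | tri< x≺y _ _  = x≺y
  ... | tri≈ _ refl _ = contradiction ranks< (<-irrefl refl)
  ... | tri> _ _ y≺x  = contradiction ranks< (<-asym (rank-mono y<n y≺x))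

  private
    rankFin : Fin n → Fin n
    rankFin i = fromℕ< (rank<n (toℕ<n i))

    toℕ-rankFin : ∀ i → toℕ (rankFin i) ≡ rank n b (suc (toℕ i))
    toℕ-rankFin i = toℕ-fromℕ< _

    rankFin-injective : Injective _≡_ _≡_ rankFin
    rankFin-injective {i} {j} eq = toℕ-injective (rank-injective (toℕ<n i) (toℕ<n j)
      (trans (sym (toℕ-rankFin i)) (trans (cong toℕ eq) (toℕ-rankFin j))))

  rank-surjective : ∀ {k} → k < n → ∃[ i ] rank n b (suc (toℕ i)) ≡ k
  rank-surjective k<n with injective⇒surjective rankFin rankFin-injective (fromℕ< k<n)
  ... | i , rankFin-i≡k = i , trans (sym (toℕ-rankFin i)) (trans (cong toℕ rankFin-i≡k) (toℕ-fromℕ< k<n))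

module ColorOrderStates {n b : ℕ} (π : Permutation′ n) where
  open ColorOrder b
  open Rank n b

  offset : Fin n → ℕ
  offset v = toℕ (π ⟨$⟩ʳ v)

  order : Fin n → ℕ
  order v = rank n b (pos π v)

  base : Fin n → ℕ
  base v = offset v / suc b

  offset<n : ∀ v → offset v < n
  offset<n v = toℕ<n (π ⟨$⟩ʳ v)

  pos-injective : ∀ {u v} → pos π u ≡ pos π v → u ≡ v
  pos-injective = Injection.injective (↔⇒↣ π) ∘ toℕ-injective ∘ suc-injective

  order-injective : ∀ {u v} → order u ≡ order v → u ≡ v
  order-injective {u} {v} orders≡ =
    pos-injective (cong suc (rank-injective (offset<n u) (offset<n v) orders≡))

  order-surjective : ∀ {k} → k < n → ∃[ v ] order v ≡ k
  order-surjective k<n with rank-surjective k<n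
  ... | i , rank≡k = π ⟨$⟩ˡ i , subst (λ j → rank n b (suc (toℕ j)) ≡ _) (sym (inverseʳ π)) rank≡k

  sₖ-just : ∀ {k} v → order v < k → sₖ n b π k v ≡ just (base v)
  sₖ-just {k} v order<k with order v <ᵇ k | <ᵇ-reflects-< (order v) k
  ... | true  | _           = cong (λ s → just (s ∸ 1)) (segment-suc b (offset v))
  ... | false | ofⁿ order≮k = contradiction order<k order≮k

  sₖ-nothing : ∀ {k} v → ¬ order v < k → sₖ n b π k v ≡ nothing
  sₖ-nothing {k} v order≮k with order v <ᵇ k | <ᵇ-reflects-< (order v) k
  ... | true  | ofʸ order<k = contradiction order<k order≮k
  ... | false | _           = refl

  sₖ-just⁻¹ : ∀ k v {i} → sₖ n b π k v ≡ just i → order v < k × i ≡ base v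
  sₖ-just⁻¹ k v sᵥ≡i with order v <? k
  ... | yes order<k = order<k , just-injective (trans (sym sᵥ≡i) (sₖ-just v order<k))
  ... | no  order≮k = contradiction (trans (sym sᵥ≡i) (sₖ-nothing v order≮k)) λ ()

  private
    order-<-suc : ∀ {k u v} → order v ≡ k → u ≢ v → order u < suc k → order u < k
    order-<-suc refl u≢v u<1+k = ≤∧≢⇒< (s≤s⁻¹ u<1+k) (u≢v ∘ order-injective)

    sₖ-defined : ∀ {k} v → order v < k → T (is-just (sₖ n b π k v))
    sₖ-defined v order<k = subst (T ∘ is-just) (sym (sₖ-just v order<k)) tt

    sₖ-defined⁻¹ : ∀ {k} v → T (is-just (sₖ n b π k v)) → order v < k
    sₖ-defined⁻¹ {k} v defined with order v <? k
    ... | yes order<k = order<k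
    ... | no  order≮k = ⊥-elim (subst (T ∘ is-just) (sₖ-nothing v order≮k) defined)

    domSize-sₖ-< : ∀ {k} → k < n → domSize (sₖ n b π k) < domSize (sₖ n b π (suc k))
    domSize-sₖ-< k<n with order-surjective k<n
    ... | v , order≡k =
      length-filterᵇ-mono-< (λ w → sₖ-defined w ∘ m<n⇒m<1+n ∘ sₖ-defined⁻¹ w) (∈-allFin v)
        (<-irrefl order≡k ∘ sₖ-defined⁻¹ v) (sₖ-defined v (s≤s (≤-reflexive order≡k)))

    domSize-sₖ≤n : ∀ k → domSize (sₖ n b π k) ≤ n
    domSize-sₖ≤n k =
      ≤-trans (length-filter (T? ∘ is-just ∘ sₖ n b π k) (allFin n)) (≤-reflexive (length-tabulate id))

  domSize-sₖ : ∀ {k} → k ≤ n → domSize (sₖ n b π k) ≡ k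
  domSize-sₖ = increasing-bounded⇒identity (λ k → domSize (sₖ n b π k)) domSize-sₖ-< (domSize-sₖ≤n n)

  sₖ-isStateCandidate : ∀ {φ} → ConsistentWith b π φ → ∀ k → IsStateCandidate n b φ (sₖ n b π k)
  sₖ-isStateCandidate {φ} consistent k v i sᵥ≡i with sₖ-just⁻¹ k v sᵥ≡i
  ... | _ , refl = /<numBase (offset<n v) , InBase⊆InSeg {lo = lo φ v} {hi = hi φ v} (consistent v)

  sₖ-stateCond1 : ∀ {k} → k ≤ n → StateCond1 n b (sₖ n b π k)
  sₖ-stateCond1 {k} k≤n = pos π , placed , (λ _ _ _ _ _ _ → pos-injective) , filled
    where
    placed : ∀ v i → sₖ n b π k v ≡ just i →
             InFirst n b (domSize (sₖ n b π k)) (pos π v) × InBase n b i (pos π v)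
    placed v i sᵥ≡i with sₖ-just⁻¹ k v sᵥ≡i
    ... | order<k , refl =
      (s≤s z≤n , offset<n v , subst (order v <_) (sym (domSize-sₖ k≤n)) order<k) , InBase-/ (offset<n v)

    filled : ∀ p → InFirst n b (domSize (sₖ n b π k)) p →
             ∃[ v ] ∃[ i ] (sₖ n b π k v ≡ just i) × (pos π v ≡ p)
    filled (suc x) (_ , x<n , rank<) = v , base v , sₖ-just v order<k , pos-v
      where
      v = π ⟨$⟩ˡ fromℕ< x<n

      pos-v : pos π v ≡ suc x
      pos-v = cong suc (trans (cong toℕ (inverseʳ π)) (toℕ-fromℕ< x<n))

      order<k : order v < k
      order<k = subst (_< k) (cong (rank n b) (sym pos-v)) (subst (rank n b (suc x) <_) (domSize-sₖ k≤n) rank<)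

  lo≤base : ∀ {φ} → ConsistentWith b π φ → ∀ v → lo φ v ℤ.≤ + base v
  lo≤base {φ} consistent v with consistent v
  ... | _ , _ , lo<pos , _ = lo*d+1≤1+m⇒lo≤m/d {lo φ v} lo<pos

  module _ {G : SimpleGraph n} (b-ordering : IsBOrdering b G π) where

    offset-nearby : ∀ {u v} → Adj G u v → offset u ≤ offset v + b
    offset-nearby {u} {v} uv = s≤s⁻¹ (∣m-n∣≤o⇒m≤n+o (b-ordering u v uv))

    base-nearby : ∀ {u v} → Adj G u v → base u ≤ suc (base v)
    base-nearby uv = m≤n+o⇒m/o≤1+n/o (≤-trans (offset-nearby uv) (+-monoʳ-≤ _ (n≤1+n b)))

    base-earlier : ∀ {u v} → Adj G u v → order u < order v → base v ≤ base u
    base-earlier {u} {v} uv order< =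
      segment-≺-nearby (rank-<⇒≺ (offset<n v) order<) (offset-nearby (SimpleGraph.sym G uv))

    sₖ-edgeOK : ∀ {φ} → ConsistentWith b π φ → ∀ k u v → Adj G u v →
                EdgeOK (sₖ n b π k u) (sₖ n b π k v) (lo φ u) (lo φ v)
    sₖ-edgeOK {φ} consistent k u v uv with order u <? k | order v <? k
    ... | yes u<k | yes v<k rewrite sₖ-just u u<k | sₖ-just v v<k =
      ∣+m-+n∣≤1 (base-nearby (SimpleGraph.sym G uv)) (base-nearby uv)
    ... | yes u<k | no  v≮k rewrite sₖ-just u u<k | sₖ-nothing v v≮k =
      ℤ.≤-trans (lo≤base {φ} consistent v) (+≤+ (base-earlier uv (<-≤-trans u<k (≮⇒≥ v≮k))))
    ... | no  u≮k | yes v<k rewrite sₖ-nothing u u≮k | sₖ-just v v<k =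
      ℤ.≤-trans (lo≤base {φ} consistent u)
                (+≤+ (base-earlier (SimpleGraph.sym G uv) (<-≤-trans v<k (≮⇒≥ u≮k))))
    ... | no  u≮k | no  v≮k rewrite sₖ-nothing u u≮k | sₖ-nothing v v≮k = tt

    sₖ-extension : ∀ {k} → k < n → IsExtension G (sₖ n b π k) (sₖ n b π (suc k))
    sₖ-extension {k} k<n with order-surjective k<n
    ... | v , order≡k =
      v , sₖ-nothing v (<-irrefl order≡k) , (base v , sₖ-just v (s≤s (≤-reflexive order≡k))) ,
      unchanged , neighbours
      where
      unchanged : ∀ w → w ≢ v → sₖ n b π (suc k) w ≡ sₖ n b π k w
      unchanged w w≢v with order w <? k
      ... | yes w<k = trans (sₖ-just w (m<n⇒m<1+n w<k)) (sym (sₖ-just w w<k))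
      ... | no  w≮k = trans (sₖ-nothing w (w≮k ∘ order-<-suc order≡k w≢v)) (sym (sₖ-nothing w w≮k))

      neighbours : ∀ u k′ i → Adj G u v →
                   sₖ n b π (suc k) u ≡ just k′ → sₖ n b π (suc k) v ≡ just i →
                   (+ k′ ℤ.- ℤ.1ℤ ℤ.≤ + i) × (i ≤ k′)
      neighbours u _ _ uv sᵤ≡k′ sᵥ≡i with sₖ-just⁻¹ (suc k) u sᵤ≡k′ | sₖ-just⁻¹ (suc k) v sᵥ≡i
      ... | u<1+k , refl | _ , refl =
        +m-1≤+n (base-nearby uv) ,
        base-earlier uv (subst (order u <_) (sym order≡k) (order-<-suc order≡k u≢v u<1+k))
        where
        u≢v : u ≢ v
        u≢v refl = SimpleGraph.irrefl G uv

lemma4 : (n b : ℕ) → 2 ≤ n → 1 ≤ b → b < n →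
         (G : SimpleGraph n) → Connected G →
         (D : RootedSpanningTree G) →
         (φ : Fin n → ℤ × ℤ) → IsSegmentAssignment n b D φ →
         (π : Permutation′ n) → IsBOrdering b G π → ConsistentWith b π φ →
         ((k : ℕ) → k ≤ n → IsState n b G φ (sₖ n b π k)) ×
         ((k : ℕ) → k < n → IsExtension G (sₖ n b π k) (sₖ n b π (suc k)))
lemma4 n b _ _ _ G _ _ φ _ π b-ordering consistent =
  (λ k k≤n → sₖ-isStateCandidate {φ} consistent k
           , sₖ-stateCond1 k≤n
           , sₖ-edgeOK {G = G} b-ordering {φ} consistent k) ,
  (λ k → sₖ-extension {G = G} b-ordering)
  where open ColorOrderStates π
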